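{- For any graph $G=(V,E,t)$, Algorithm TPI($G$) returns a link vector ${\bf s}$ for $G$ such that $$\sum_{v\in V}s(v)\le\sum_{v\in V}\frac{t(v)\,(t(v)+1)}{2\,(d_G(v)+1)},$$ where $d_G(v)$ is the degree of $v$ in $G$.
   Context: The graph $G=(V,E)$ is finite, simple and undirected, with threshold function $t:V\to\mathbb{Z}^+$. A link vector is ${\bf s}=(s(v))_{v\in V}$ of nonnegative integers, where $s(v)$ is the number of links to $v$ from external (already active) influencers. Algorithm TPI($G$) proceeds as follows. Initialize $W=V$, and for each $v\in V$ set $s(v)=0$, $\delta(v)=d_G(v)$, $k(v)=t(v)$, $N(v)=\Gamma_G(v)$ (the neighbourhood). Then, while $W\ne\emptyset$, perform one of two cases. Case 1: if some $v\in W$ has $k(v)>\delta(v)$, choose such a $v$, set $s(v)\leftarrow s(v)+k(v)-\delta(v)$ and $k(v)\leftarrow\delta(v)$, and if now $k(v)=0$ remove $v$ from $W$. Case 2: otherwise, choose $v\in W$ maximizing $\frac{k(u)(k(u)+1)}{\delta(u)(\delta(u)+1)}$ over $u\in W$. For each $u\in N(v)$ set $\delta(u)\leftarrow\delta(u)-1$ and $N(u)\leftarrow N(u)\setminus\{v\}$, and then remove $v$ from $W$. When $W=\emptyset$, return ${\bf s}$. Ties and choices are made arbitrarily. -}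

module Defs where

open import Data.Nat using (ℕ; zero; suc; _+_; _*_; _∸_; _≤_; _<_)
open import Data.Bool using (Bool; true; false; if_then_else_; _∧_)
open import Data.Fin using (Fin; _≟_)
open import Data.List using (List; foldr; map)
open import Data.Nat.ListAction using () renaming (sum to sumℕ)
open import Data.Integer using (+_)
open import Data.Rational using (ℚ; _/_) renaming (_+_ to _+ℚ_; 0ℚ to 0ℚ)
open import Relation.Nullary using (does)
open import Relation.Binary.PropositionalEquality using (_≡_)

open import Data.List using (allFin) public

record Graph (n : ℕ) : Set where
  field
    adj    : Fin n → Fin n → Bool
    sym    : ∀ u v → adj u v ≡ adj v u
    irrefl : ∀ v → adj v v ≡ false
open Graph public

deg : ∀ {n} → Graph n → Fin n → ℕ
deg {n} G v = sumℕ (map (λ u → if adj G v u then 1 else 0) (allFin n))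

Σℕ : ∀ {n} → (Fin n → ℕ) → ℕ
Σℕ {n} f = sumℕ (map f (allFin n))

Σℚ : ∀ {n} → (Fin n → ℚ) → ℚ
Σℚ {n} f = foldr _+ℚ_ 0ℚ (map f (allFin n))

upd : ∀ {n} {A : Set} → (Fin n → A) → Fin n → A → Fin n → A
upd f v x u = if does (u ≟ v) then x else f u

record State (n : ℕ) : Set where
  field
    W : Fin n → Bool
    s : Fin n → ℕ
    δ : Fin n → ℕ
    k : Fin n → ℕ
    N : Fin n → Fin n → Bool
open State public

initState : ∀ {n} → Graph n → (Fin n → ℕ) → State n
initState G t = record
  { W = λ _ → true
  ; s = λ _ → 0
  ; δ = deg G
  ; k = t
  ; N = adj G
  }

-- One iteration of the while loop (nondeterministic: any admissible choice).
data Step {n : ℕ} : State n → State n → Set where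
  case1 : (st : State n) (v : Fin n) →
          W st v ≡ true → δ st v < k st v →
          Step st record st
            { s = upd (s st) v (s st v + (k st v ∸ δ st v))
            ; k = upd (k st) v (δ st v)
            ; W = upd (W st) v (if does (δ st v Data.Nat.≟ 0) then false else true)
            }
  -- Case 2: only when no u ∈ W has k(u) > δ(u); v maximizes
  -- k(u)(k(u)+1)/(δ(u)(δ(u)+1)) over W (comparison written by
  -- cross-multiplication; all denominators are positive in this case).
  case2 : (st : State n) (v : Fin n) →
          (∀ u → W st u ≡ true → k st u ≤ δ st u) →
          W st v ≡ true →
          (∀ u → W st u ≡ true →
             k st u * suc (k st u) * (δ st v * suc (δ st v))
               ≤ k st v * suc (k st v) * (δ st u * suc (δ st u))) →
          Step st record st
            { δ = λ u → if N st v u then δ st u ∸ 1 else δ st u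
            ; N = λ u w → if N st v u ∧ does (w ≟ v) then false else N st u w
            ; W = upd (W st) v false
            }

data Run {n : ℕ} : State n → State n → Set where
  done : ∀ {st} → Run st st
  step : ∀ {st st′ st″} → Step st st′ → Run st′ st″ → Run st st″

TPI-returns : ∀ {n} → Graph n → (Fin n → ℕ) → (Fin n → ℕ) → Set
TPI-returns {n} G t out =
  Data.Product.Σ (State n) λ fin →
    Run (initState G t) fin Data.Product.× ((∀ v → W fin v ≡ false) Data.Product.× (s fin ≡ out))
  where import Data.Product

bound : ∀ {n} → Graph n → (Fin n → ℕ) → ℚ
bound G t = Σℚ λ v → (+ (t v * suc (t v))) / (suc (deg G v) + suc (deg G v))

-- Along a run of TPI consider the potential
--   Φ = Σ_{v ∈ W} k(v)(k(v)+1) / (2(δ(v)+1)) + Σ_v s(v),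
-- which equals the bound at the start and Σ s at the end; it suffices that no step increases it.
-- In Case 1, raising s(v) by k − δ and lowering k(v) to δ removes
-- (k − δ)(k + δ + 1) / (2(δ+1)) ≥ k − δ from the v-term.
-- In Case 2, removing v frees k(k+1)/(2(δ+1)) = δ · ρ(v), where ρ = k(k+1)/(2δ(δ+1)) is half the
-- quantity the algorithm maximises; each of the δ(v) neighbours u ∈ W loses one degree, which raises
-- its term by exactly ρ(u) ≤ ρ(v).
module Submission where

open import Defs
open import Data.Nat using (ℕ; _≤_)
open import Data.Fin using (Fin)
open import Data.Integer using (+_)
open import Data.Rational using (ℚ) renaming (_≤_ to _≤ℚ_)

open import Data.Nat using (zero; suc; _+_; _*_; _∸_; _<_; z≤n; s≤s; NonZero)
import Data.Nat as ℕ
import Data.Nat.Properties as ℕP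
open import Data.Nat.ListAction using () renaming (sum to sumℕ)
open import Data.Nat.Tactic.RingSolver using (solve-∀)
open import Data.Bool using (Bool; true; false; if_then_else_; _∧_)
import Data.Bool.Properties as BoolP
open import Data.Fin using (zero; suc; _≟_)
open import Data.List using (_∷_; foldr; map)
open import Data.List.Properties using (map-tabulate)
open import Data.Product using (_×_; _,_)
import Data.Integer as ℤ
import Data.Integer.Properties as ℤP
import Data.Rational as ℚ
import Data.Rational.Properties as ℚP
open import Data.Rational.Unnormalised as U
  using (ℚᵘ; mkℚᵘ; 0ℚᵘ; *≤*; *≡*)
  renaming (_+_ to _+ᵘ_; _*_ to _*ᵘ_; _≤_ to _≤ᵘ_; _≃_ to _≃ᵘ_)
import Data.Rational.Unnormalised.Properties as UP
open import Algebra.Bundles using (CommutativeRing)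
open import Algebra.Properties.Semiring.Sum (CommutativeRing.semiring UP.+-*-commutativeRing)
  using (sum; sum-syntax; ∑-distrib-+; sum-cong-≋; sum-replicate-zero; *-distribʳ-sum)
open import Algebra.Solver.CommutativeMonoid UP.+-0-commutativeMonoid
  using (solve; _⊕_; _⊜_) renaming (id to ε)
open import Data.Empty using (⊥-elim)
open import Function using (_∘_; id)
open import Relation.Nullary using (does; yes; no)
open import Relation.Binary.PropositionalEquality as ≡
  using (_≡_; _≢_; refl; trans; cong; cong₂; subst; subst₂)

frac : ℕ → (D : ℕ) → .{{NonZero D}} → ℚᵘ
frac a D = + a U./ D

frac-mono : ∀ {a b} A B .{{_ : NonZero A}} .{{_ : NonZero B}} →
            a * B ≤ b * A → frac a A ≤ᵘ frac b B
frac-mono {a} {b} (suc A) (suc B) le =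
  *≤* (subst₂ ℤ._≤_ (ℤP.pos-* a (suc B)) (ℤP.pos-* b (suc A)) (ℤ.+≤+ le))

frac-cong : ∀ {a b} A B .{{_ : NonZero A}} .{{_ : NonZero B}} →
            a * B ≡ b * A → frac a A ≃ᵘ frac b B
frac-cong {a} {b} (suc A) (suc B) eq =
  *≡* (trans (≡.sym (ℤP.pos-* a (suc B))) (trans (cong +_ eq) (ℤP.pos-* b (suc A))))

frac-monoˡ : ∀ {a b} D .{{_ : NonZero D}} → a ≤ b → frac a D ≤ᵘ frac b D
frac-monoˡ D a≤b = frac-mono D D (ℕP.*-monoˡ-≤ D a≤b)

frac-nonNeg : ∀ a D .{{_ : NonZero D}} → 0ℚᵘ ≤ᵘ frac a D
frac-nonNeg a D = frac-mono 1 D z≤n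

frac-+ : ∀ a b A B .{{_ : NonZero A}} .{{_ : NonZero B}} →
         frac a A +ᵘ frac b B ≡ frac (a * B + b * A) (A * B) {{ℕP.m*n≢0 A B}}
frac-+ a b (suc A) (suc B) = cong (λ z → mkℚᵘ z (B + A * suc B))
  (trans (cong₂ ℤ._+_ (≡.sym (ℤP.pos-* a (suc B))) (≡.sym (ℤP.pos-* b (suc A))))
         (≡.sym (ℤP.pos-+ (a * suc B) (b * suc A))))

frac-* : ∀ a b A B .{{_ : NonZero A}} .{{_ : NonZero B}} →
         frac a A *ᵘ frac b B ≡ frac (a * b) (A * B) {{ℕP.m*n≢0 A B}}
frac-* a b (suc A) (suc B) = cong (λ z → mkℚᵘ z (B + A * suc B)) (≡.sym (ℤP.pos-* a b))

frac-homo-+ : ∀ a b → frac (a + b) 1 ≃ᵘ frac a 1 +ᵘ frac b 1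
frac-homo-+ a b = UP.≃-reflexive (≡.sym (trans (frac-+ a b 1 1)
  (cong (λ z → frac z 1) (cong₂ _+_ (ℕP.*-identityʳ a) (ℕP.*-identityʳ b)))))

weight : ℕ → ℕ → ℚᵘ
weight k d = frac (k * suc k) (suc d + suc d)

weight-nonNeg : ∀ k d → 0ℚᵘ ≤ᵘ weight k d
weight-nonNeg k d = frac-nonNeg (k * suc k) (suc d + suc d)

-- ratio k d = weight k (d − 1) − weight k d (and the junk value 0 at d = 0).
ratio : ℕ → ℕ → ℚᵘ
ratio k zero    = 0ℚᵘ
ratio k (suc d) = frac (k * suc k) (suc d * suc (suc d) + suc d * suc (suc d))

weight-shed : ∀ s {k d} → d < k →
              weight d d +ᵘ frac (s + (k ∸ d)) 1 ≤ᵘ weight k d +ᵘ frac s 1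
weight-shed s {k} {d} d<k
  with k ∸ d | ℕP.m+[n∸m]≡n (ℕP.<⇒≤ d<k) | ℕP.m<n⇒0<n∸m d<k
... | suc m | refl | _ =
  subst₂ _≤ᵘ_ (≡.sym (frac-+ (d * suc d) (s + suc m) D 1))
              (≡.sym (frac-+ ((d + suc m) * suc (d + suc m)) s D 1))
    (frac-monoˡ (D * 1) (subst (before ≤_) (≡.sym (shed d m s)) (ℕP.m≤m+n before (m * suc m))))
  where
  D = suc d + suc d
  before = d * suc d * 1 + (s + suc m) * D
  shed : ∀ d m s → (d + suc m) * suc (d + suc m) * 1 + s * (suc d + suc d)
                   ≡ d * suc d * 1 + (s + suc m) * (suc d + suc d) + m * suc m
  shed = solve-∀

ratio-nonNeg : ∀ k d → 0ℚᵘ ≤ᵘ ratio k d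
ratio-nonNeg k zero    = UP.≤-refl
ratio-nonNeg k (suc d) = frac-nonNeg (k * suc k) _

weight-pred : ∀ k {d} → 1 ≤ d → weight k (d ∸ 1) ≃ᵘ weight k d +ᵘ ratio k d
weight-pred k {suc e} _ = UP.≃-trans
  (frac-cong (suc e + suc e) (Q * P) (split (k * suc k) e))
  (UP.≃-reflexive (≡.sym (frac-+ (k * suc k) (k * suc k) Q P)))
  where
  Q = suc (suc e) + suc (suc e)
  P = suc e * suc (suc e) + suc e * suc (suc e)
  split : ∀ K e → K * ((suc (suc e) + suc (suc e)) * (suc e * suc (suc e) + suc e * suc (suc e)))
                ≡ (K * (suc e * suc (suc e) + suc e * suc (suc e)) + K * (suc (suc e) + suc (suc e)))
                  * (suc e + suc e)
  split = solve-∀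

ratio-mono : ∀ {k d k′ d′} → 1 ≤ d′ →
             k * suc k * (d′ * suc d′) ≤ k′ * suc k′ * (d * suc d) →
             ratio k d ≤ᵘ ratio k′ d′
ratio-mono {k} {zero}  {k′} {d′}    _ _  = ratio-nonNeg k′ d′
ratio-mono {k} {suc d} {k′} {suc d′} _ le = frac-mono (P + P) (P′ + P′)
  (subst₂ _≤_ (≡.sym (ℕP.*-distribˡ-+ K P′ P′)) (≡.sym (ℕP.*-distribˡ-+ K′ P P)) (ℕP.+-mono-≤ le le))
  where
  K = k * suc k
  K′ = k′ * suc k′
  P = suc d * suc (suc d)
  P′ = suc d′ * suc (suc d′)

ratio-total : ∀ k d → frac d 1 *ᵘ ratio k d ≤ᵘ weight k d
ratio-total k zero    = subst (_≤ᵘ weight k zero) (≡.sym (frac-* 0 0 1 1)) (weight-nonNeg k zero)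
ratio-total k (suc e) = subst (_≤ᵘ weight k (suc e)) (≡.sym (frac-* (suc e) K 1 P))
  (UP.≤-reflexive (frac-cong (1 * P) (suc (suc e) + suc (suc e)) (cancel K e)))
  where
  K = k * suc k
  P = suc e * suc (suc e) + suc e * suc (suc e)
  cancel : ∀ K e → suc e * K * (suc (suc e) + suc (suc e))
                 ≡ K * (1 * (suc e * suc (suc e) + suc e * suc (suc e)))
  cancel = solve-∀

if-0-≤ : ∀ b {x} → 0ℚᵘ ≤ᵘ x → (if b then x else 0ℚᵘ) ≤ᵘ x
if-0-≤ true  _   = UP.≤-refl
if-0-≤ false 0≤x = 0≤x

if-0-nonNeg : ∀ b {x} → 0ℚᵘ ≤ᵘ x → 0ℚᵘ ≤ᵘ (if b then x else 0ℚᵘ)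
if-0-nonNeg true  0≤x = 0≤x
if-0-nonNeg false _   = UP.≤-refl

+-cancelʳ-≤ : ∀ {x y} a → x +ᵘ a ≤ᵘ y +ᵘ a → x ≤ᵘ y
+-cancelʳ-≤ {x} {y} a x+a≤y+a = begin
  x                  ≃⟨ UP.≃-sym (UP.+-identityʳ x) ⟩
  x +ᵘ 0ℚᵘ           ≃⟨ UP.+-congʳ x (UP.≃-sym (UP.+-inverseʳ a)) ⟩
  x +ᵘ (a U.- a)     ≃⟨ UP.≃-sym (UP.+-assoc x a (U.- a)) ⟩
  (x +ᵘ a) U.- a     ≤⟨ UP.+-monoˡ-≤ (U.- a) x+a≤y+a ⟩
  (y +ᵘ a) U.- a     ≃⟨ UP.+-assoc y a (U.- a) ⟩
  y +ᵘ (a U.- a)     ≃⟨ UP.+-congʳ y (UP.+-inverseʳ a) ⟩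
  y +ᵘ 0ℚᵘ           ≃⟨ UP.+-identityʳ y ⟩
  y                  ∎
  where open UP.≤-Reasoning

weight-pred-≤ : ∀ k {d} x r → 1 ≤ d → ratio k d ≤ᵘ r →
                (weight k (d ∸ 1) +ᵘ x) +ᵘ 0ℚᵘ ≤ᵘ (weight k d +ᵘ x) +ᵘ r
weight-pred-≤ k {d} x r 1≤d ρ≤r = begin
  (weight k (d ∸ 1) +ᵘ x) +ᵘ 0ℚᵘ ≃⟨ UP.+-identityʳ _ ⟩
  weight k (d ∸ 1) +ᵘ x          ≃⟨ UP.+-congˡ x (weight-pred k 1≤d) ⟩
  (weight k d +ᵘ ratio k d) +ᵘ x ≤⟨ UP.+-monoˡ-≤ x (UP.+-monoʳ-≤ (weight k d) ρ≤r) ⟩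
  (weight k d +ᵘ r) +ᵘ x         ≃⟨ swap (weight k d) r x ⟩
  (weight k d +ᵘ x) +ᵘ r         ∎
  where
  open UP.≤-Reasoning
  swap : ∀ a b c → (a +ᵘ b) +ᵘ c ≃ᵘ (a +ᵘ c) +ᵘ b
  swap = solve 3 (λ a b c → (a ⊕ b) ⊕ c ⊜ (a ⊕ c) ⊕ b) UP.≃-refl

removal-≤ : ∀ w x {y} → 0ℚᵘ ≤ᵘ y → (0ℚᵘ +ᵘ x) +ᵘ w ≤ᵘ (w +ᵘ x) +ᵘ y
removal-≤ w x {y} 0≤y = UP.≤-respˡ-≃ (solve 2 (λ w x → (w ⊕ x) ⊕ ε ⊜ (ε ⊕ x) ⊕ w) UP.≃-refl w x)
                                      (UP.+-monoʳ-≤ (w +ᵘ x) 0≤y)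

map-allFin-suc : ∀ {A : Set} {n} (f : Fin (suc n) → A) →
                 map f (allFin (suc n)) ≡ f zero ∷ map (f ∘ suc) (allFin n)
map-allFin-suc f = cong (f zero ∷_) (trans (map-tabulate suc f) (≡.sym (map-tabulate id (f ∘ suc))))

∑-homo : ∀ {A : Set} (_∙_ : A → A → A) (e : A) (h : A → ℚᵘ) →
         h e ≃ᵘ 0ℚᵘ → (∀ x y → h (x ∙ y) ≃ᵘ h x +ᵘ h y) →
         ∀ {n} (f : Fin n → A) → h (foldr _∙_ e (map f (allFin n))) ≃ᵘ ∑[ u < n ] h (f u)
∑-homo _∙_ e h h-e h-∙ {zero}  f = h-e
∑-homo _∙_ e h h-e h-∙ {suc n} f = begin
  h (foldr _∙_ e (map f (allFin (suc n))))
    ≡⟨ cong (h ∘ foldr _∙_ e) (map-allFin-suc f) ⟩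
  h (f zero ∙ foldr _∙_ e (map (f ∘ suc) (allFin n)))
    ≈⟨ h-∙ _ _ ⟩
  h (f zero) +ᵘ h (foldr _∙_ e (map (f ∘ suc) (allFin n)))
    ≈⟨ UP.+-congʳ (h (f zero)) (∑-homo _∙_ e h h-e h-∙ (f ∘ suc)) ⟩
  h (f zero) +ᵘ ∑[ u < n ] h (f (suc u))
    ∎
  where open UP.≃-Reasoning

∑-mono-≤ : ∀ {n} {f g : Fin n → ℚᵘ} → (∀ u → f u ≤ᵘ g u) → ∑[ u < n ] f u ≤ᵘ ∑[ u < n ] g u
∑-mono-≤ {zero}  f≤g = UP.≤-refl
∑-mono-≤ {suc n} f≤g = UP.+-mono-≤ (f≤g zero) (∑-mono-≤ (f≤g ∘ suc))

frac-Σℕ : ∀ {n} (f : Fin n → ℕ) → frac (Σℕ f) 1 ≃ᵘ ∑[ u < n ] frac (f u) 1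
frac-Σℕ = ∑-homo _+_ 0 (λ a → frac a 1) UP.≃-refl frac-homo-+

count : ∀ {n} → (Fin n → Bool) → ℕ
count b = Σℕ (λ u → if b u then 1 else 0)

∑-count : ∀ {n} (b : Fin n → Bool) c →
          ∑[ u < n ] (if b u then c else 0ℚᵘ) ≃ᵘ frac (count b) 1 *ᵘ c
∑-count {n} b c = begin
  ∑[ u < n ] (if b u then c else 0ℚᵘ)  ≈⟨ sum-cong-≋ (λ u → select (b u)) ⟩
  ∑[ u < n ] (indicator u *ᵘ c)         ≈⟨ UP.≃-sym (*-distribʳ-sum c indicator) ⟩
  (∑[ u < n ] indicator u) *ᵘ c         ≈⟨ UP.*-congʳ (UP.≃-sym (frac-Σℕ (λ u → if b u then 1 else 0))) ⟩
  frac (count b) 1 *ᵘ c                 ∎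
  where
  open UP.≃-Reasoning
  indicator : Fin n → ℚᵘ
  indicator u = frac (if b u then 1 else 0) 1
  select : ∀ x → (if x then c else 0ℚᵘ) ≃ᵘ frac (if x then 1 else 0) 1 *ᵘ c
  select true  = UP.≃-sym (UP.*-identityˡ c)
  select false = UP.≃-sym (UP.*-zeroˡ c)

∑-indicator : ∀ {n} v a → ∑[ u < n ] (if does (u ≟ v) then a else 0ℚᵘ) ≃ᵘ a
∑-indicator {suc n} zero    a = UP.≃-trans (UP.+-congʳ a (sum-replicate-zero n)) (UP.+-identityʳ a)
∑-indicator {suc n} (suc v) a = UP.≃-trans (UP.+-identityˡ _) (∑-indicator v a)

∑-≤-by-transfer : ∀ {n} {f g : Fin n → ℚᵘ} v a (b : Fin n → Bool) c →
  (∀ u → f u +ᵘ (if does (u ≟ v) then a else 0ℚᵘ) ≤ᵘ g u +ᵘ (if b u then c else 0ℚᵘ)) →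
  frac (count b) 1 *ᵘ c ≤ᵘ a →
  ∑[ u < n ] f u ≤ᵘ ∑[ u < n ] g u
∑-≤-by-transfer {n} {f} {g} v a b c pointwise paid = +-cancelʳ-≤ a (begin
  sum f +ᵘ a                                       ≃⟨ UP.+-congʳ (sum f) (UP.≃-sym (∑-indicator v a)) ⟩
  sum f +ᵘ sum (λ u → if does (u ≟ v) then a else 0ℚᵘ) ≃⟨ UP.≃-sym (∑-distrib-+ f _) ⟩
  sum (λ u → f u +ᵘ (if does (u ≟ v) then a else 0ℚᵘ)) ≤⟨ ∑-mono-≤ pointwise ⟩
  sum (λ u → g u +ᵘ (if b u then c else 0ℚᵘ))         ≃⟨ ∑-distrib-+ g _ ⟩
  sum g +ᵘ sum (λ u → if b u then c else 0ℚᵘ)          ≃⟨ UP.+-congʳ (sum g) (∑-count b c) ⟩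
  sum g +ᵘ frac (count b) 1 *ᵘ c                     ≤⟨ UP.+-monoʳ-≤ (sum g) paid ⟩
  sum g +ᵘ a                                         ∎)
  where open UP.≤-Reasoning

count-suc : ∀ {n} (b : Fin (suc n) → Bool) → count b ≡ (if b zero then 1 else 0) + count (b ∘ suc)
count-suc b = cong sumℕ (map-allFin-suc (λ w → if b w then 1 else 0))

_without_ : ∀ {n} → (Fin n → Bool) → Fin n → Fin n → Bool
(b without v) w = if does (w ≟ v) then false else b w

count-remove : ∀ {n} (b : Fin n → Bool) {v} → b v ≡ true → count b ≡ suc (count (b without v))
count-remove {suc n} b {zero} bv≡true = begin
  count b                                      ≡⟨ count-suc b ⟩
  (if b zero then 1 else 0) + count (b ∘ suc)  ≡⟨ cong (λ x → (if x then 1 else 0) + count (b ∘ suc)) bv≡true ⟩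
  suc (count (b ∘ suc))                        ≡⟨ cong suc (≡.sym (count-suc (b without zero))) ⟩
  suc (count (b without zero))                 ∎
  where open ≡.≡-Reasoning
count-remove {suc n} b {suc v} bv≡true = begin
  count b                                                  ≡⟨ count-suc b ⟩
  b₀ + count (b ∘ suc)                                     ≡⟨ cong (_+_ b₀) (count-remove (b ∘ suc) bv≡true) ⟩
  b₀ + suc (count ((b ∘ suc) without v))                   ≡⟨ ℕP.+-suc b₀ _ ⟩
  suc (b₀ + count ((b ∘ suc) without v))                   ≡⟨ cong suc (≡.sym (count-suc (b without suc v))) ⟩
  suc (count (b without suc v))                            ∎
  where
  open ≡.≡-Reasoning
  b₀ = if b zero then 1 else 0

count-pos : ∀ {n} (b : Fin n → Bool) {v} → b v ≡ true → 1 ≤ count b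
count-pos b bv≡true rewrite count-remove b bv≡true = s≤s z≤n

-- Removed vertices keep stale N and δ entries, so both facts are only claimed on W.
record Invariant {n} (st : State n) : Set where
  field
    N-sym   : ∀ {u w} → W st u ≡ true → W st w ≡ true → N st u w ≡ N st w u
    δ-count : ∀ {u} → W st u ≡ true → δ st u ≡ count (N st u)
open Invariant

Invariant-init : ∀ {n} (G : Graph n) t → Invariant (initState G t)
Invariant-init G t = record { N-sym = λ {u} {w} _ _ → Graph.sym G u w ; δ-count = λ _ → refl }

upd-≡-true : ∀ {n} (f : Fin n → Bool) {v} b {u} → f v ≡ true → upd f v b u ≡ true → f u ≡ true
upd-≡-true f {v} b {u} fv≡true fu≡true with u ≟ v
... | yes refl = fv≡true
... | no _     = fu≡true

upd-false-≡-true : ∀ {n} (f : Fin n → Bool) {v u} → upd f v false u ≡ true → u ≢ v × f u ≡ true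
upd-false-≡-true f {v} {u} fu≡true with u ≟ v
... | no u≢v = u≢v , fu≡true
... | yes _ with () ← fu≡true

if-∧-≟-other : ∀ {n} b {w v : Fin n} x → w ≢ v → (if b ∧ does (w ≟ v) then false else x) ≡ x
if-∧-≟-other b {w} {v} x w≢v with w ≟ v
... | yes w≡v = ⊥-elim (w≢v w≡v)
... | no _ rewrite BoolP.∧-zeroʳ b = refl

Invariant-step : ∀ {n} {st st′ : State n} → Step st st′ → Invariant st → Invariant st′
Invariant-step (case1 st v Wv _) inv = record
  { N-sym   = λ Wu Ww → N-sym inv (upd-≡-true (W st) _ Wv Wu) (upd-≡-true (W st) _ Wv Ww)
  ; δ-count = λ Wu → δ-count inv (upd-≡-true (W st) _ Wv Wu)
  }
Invariant-step (case2 st v _ Wv _) inv = record { N-sym = N-sym′ ; δ-count = δ-count′ }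
  where
  N-sym′ : ∀ {u w} → upd (W st) v false u ≡ true → upd (W st) v false w ≡ true →
           (if N st v u ∧ does (w ≟ v) then false else N st u w)
           ≡ (if N st v w ∧ does (u ≟ v) then false else N st w u)
  N-sym′ {u} {w} Wu′ Ww′ with upd-false-≡-true (W st) Wu′ | upd-false-≡-true (W st) Ww′
  ... | u≢v , Wu | w≢v , Ww = trans (if-∧-≟-other (N st v u) (N st u w) w≢v)
    (trans (N-sym inv Wu Ww) (≡.sym (if-∧-≟-other (N st v w) (N st w u) u≢v)))
  δ-count′ : ∀ {u} → upd (W st) v false u ≡ true →
             (if N st v u then δ st u ∸ 1 else δ st u)
             ≡ count (λ w → if N st v u ∧ does (w ≟ v) then false else N st u w)
  δ-count′ {u} Wu′ with upd-false-≡-true (W st) Wu′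
  ... | _ , Wu with N st v u in Nvu
  ...   | true  = cong (_∸ 1) (trans (δ-count inv Wu) (count-remove (N st u) (trans (N-sym inv Wu Wv) Nvu)))
  ...   | false = δ-count inv Wu

potential : ∀ {n} → State n → Fin n → ℚᵘ
potential st u = (if W st u then weight (k st u) (δ st u) else 0ℚᵘ) +ᵘ frac (s st u) 1

Φ : ∀ {n} → State n → ℚᵘ
Φ {n} st = ∑[ u < n ] potential st u

Φ-step : ∀ {n} {st st′ : State n} → Step st st′ → Invariant st → Φ st′ ≤ᵘ Φ st
Φ-step {st′ = st′} (case1 st v Wv δ<k) _ = ∑-mono-≤ pointwise
  where
  pointwise : ∀ u → potential st′ u ≤ᵘ potential st u
  pointwise u with u ≟ v
  ... | no _     = UP.≤-refl
  ... | yes refl rewrite Wv = UP.≤-trans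
    (UP.+-monoˡ-≤ (frac (s st v + (k st v ∸ δ st v)) 1)
                  (if-0-≤ (if does (δ st v ℕ.≟ 0) then false else true) (weight-nonNeg (δ st v) (δ st v))))
    (weight-shed (s st v) δ<k)
Φ-step {st′ = st′} (case2 st v _ Wv maximal) inv =
  ∑-≤-by-transfer v (weight kᵥ δᵥ) (N st v) (ratio kᵥ δᵥ) pointwise paid
  where
  kᵥ = k st v
  δᵥ = δ st v
  paid : frac (count (N st v)) 1 *ᵘ ratio kᵥ δᵥ ≤ᵘ weight kᵥ δᵥ
  paid rewrite ≡.sym (δ-count inv Wv) = ratio-total kᵥ δᵥ
  pointwise : ∀ u → potential st′ u +ᵘ (if does (u ≟ v) then weight kᵥ δᵥ else 0ℚᵘ)
                    ≤ᵘ potential st u +ᵘ (if N st v u then ratio kᵥ δᵥ else 0ℚᵘ)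
  pointwise u with u ≟ v
  ... | yes refl rewrite Wv =
    removal-≤ (weight kᵥ δᵥ) (frac (s st v) 1) (if-0-nonNeg (N st v v) (ratio-nonNeg kᵥ δᵥ))
  ... | no _ with W st u in Wu
  ...   | false = UP.+-monoʳ-≤ (0ℚᵘ +ᵘ frac (s st u) 1) (if-0-nonNeg (N st v u) (ratio-nonNeg kᵥ δᵥ))
  ...   | true with N st v u in Nvu
  ...     | false = UP.≤-refl
  ...     | true  = weight-pred-≤ (k st u) (frac (s st u) 1) (ratio kᵥ δᵥ) 1≤δᵤ
                      (ratio-mono {k st u} {δ st u} 1≤δᵥ (maximal u Wu))
    where
    1≤δᵤ : 1 ≤ δ st u
    1≤δᵤ rewrite δ-count inv Wu = count-pos (N st u) (trans (N-sym inv Wu Wv) Nvu)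
    1≤δᵥ : 1 ≤ δᵥ
    1≤δᵥ rewrite δ-count inv Wv = count-pos (N st v) Nvu

Φ-run : ∀ {n} {st fin : State n} → Run st fin → Invariant st → Φ fin ≤ᵘ Φ st
Φ-run done           _   = UP.≤-refl
Φ-run (step st→ run) inv = UP.≤-trans (Φ-run run (Invariant-step st→ inv)) (Φ-step st→ inv)

toℚᵘ-/ : ∀ a D .{{_ : NonZero D}} → ℚ.toℚᵘ ((+ a) ℚ./ D) ≃ᵘ frac a D
toℚᵘ-/ a (suc D) = ℚP.toℚᵘ-fromℚᵘ (mkℚᵘ (+ a) D)

toℚᵘ-Σℚ : ∀ {n} (f : Fin n → ℚ) → ℚ.toℚᵘ (Σℚ f) ≃ᵘ ∑[ u < n ] ℚ.toℚᵘ (f u)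
toℚᵘ-Σℚ = ∑-homo ℚ._+_ ℚ.0ℚ ℚ.toℚᵘ UP.≃-refl ℚP.toℚᵘ-homo-+

Φ-init : ∀ {n} (G : Graph n) t → Φ (initState G t) ≃ᵘ ℚ.toℚᵘ (bound G t)
Φ-init {n} G t = UP.≃-trans (sum-cong-≋ {n} initial) (UP.≃-sym (toℚᵘ-Σℚ vertexBound))
  where
  vertexBound : Fin n → ℚ
  vertexBound u = (+ (t u * suc (t u))) ℚ./ (suc (deg G u) + suc (deg G u))
  initial : ∀ u → potential (initState G t) u ≃ᵘ ℚ.toℚᵘ (vertexBound u)
  initial u = UP.≃-trans (UP.+-identityʳ _)
                         (UP.≃-sym (toℚᵘ-/ (t u * suc (t u)) (suc (deg G u) + suc (deg G u))))

Φ-final : ∀ {n} {fin : State n} → (∀ v → W fin v ≡ false) → Φ fin ≃ᵘ frac (Σℕ (s fin)) 1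
Φ-final {fin = fin} W≡∅ = UP.≃-trans (sum-cong-≋ inactive) (UP.≃-sym (frac-Σℕ (s fin)))
  where
  inactive : ∀ u → potential fin u ≃ᵘ frac (s fin u) 1
  inactive u rewrite W≡∅ u = UP.+-identityˡ _

mainTheorem12 : ∀ (n : ℕ) (G : Graph n) (t : Fin n → ℕ) →
    (∀ v → 1 ≤ t v) →
    ∀ (out : Fin n → ℕ) → TPI-returns G t out →
    (+ Σℕ out) Data.Rational./ 1 ≤ℚ bound G t
mainTheorem12 n G t _ out (fin , run , W≡∅ , refl) = ℚP.toℚᵘ-cancel-≤ (begin
  ℚ.toℚᵘ ((+ Σℕ (s fin)) ℚ./ 1) ≃⟨ toℚᵘ-/ (Σℕ (s fin)) 1 ⟩
  frac (Σℕ (s fin)) 1           ≃⟨ UP.≃-sym (Φ-final {fin = fin} W≡∅) ⟩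
  Φ fin                         ≤⟨ Φ-run run (Invariant-init G t) ⟩
  Φ (initState G t)             ≃⟨ Φ-init G t ⟩
  ℚ.toℚᵘ (bound G t)            ∎)
  where open UP.≤-Reasoning
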